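{- Let $G$ be a graph on $n$ vertices and $k\ge 1$ an integer. Then $G$ or its complement $\overline{G}$ has a minor $H$ with $\Delta(H)\ge n-k$ if and only if $\min(\gamma_c(G),\gamma_c(\overline{G}))\le k$.
   Context: All graphs are finite, simple and undirected; $\overline{G}$ denotes the complement of $G$. A minor of $G$ is a graph obtained from $G$ by a sequence of vertex deletions, edge deletions and edge contractions. $\Delta(H)$ is the maximum degree of $H$. A set $S\subseteq V(G)$ is dominating if every vertex outside $S$ is adjacent to some vertex of $S$. The connected domination number $\gamma_c(G)$ is the minimum cardinality of a dominating set $S$ whose induced subgraph $G[S]$ is connected (for a disconnected graph no such set exists, and $\gamma_c$ is taken to be $\infty$). -}

module Defs where

open import Data.Nat using (ℕ; zero; suc; _≤_; _⊔_)
open import Data.Bool using (Bool; true; false; _∧_; _∨_; not; if_then_else_)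
open import Data.Fin using (Fin; punchIn) renaming (_≟_ to _≟ᶠ_)
open import Data.Fin.Subset using (Subset; _∈_; _∉_; ∣_∣)
open import Data.List using (List; allFin; map; foldr)
open import Data.Bool.ListAction using (any)
open import Data.Nat.ListAction using (sum)
open import Data.Product using (Σ; _×_; ∃; ∃-syntax)
open import Relation.Nullary.Decidable using (⌊_⌋)
open import Relation.Binary.PropositionalEquality using (_≡_)

Graph : ℕ → Set
Graph n = Fin n → Fin n → Bool

IsSimple : ∀ {n} → Graph n → Set
IsSimple {n} G = (∀ (u v : Fin n) → G u v ≡ G v u) × (∀ (v : Fin n) → G v v ≡ false)

_==_ : ∀ {n} → Fin n → Fin n → Bool
x == y = ⌊ x ≟ᶠ y ⌋

complement : ∀ {n} → Graph n → Graph n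
complement G u v = not (u == v) ∧ not (G u v)

anyFin : ∀ {n} → (Fin n → Bool) → Bool
anyFin {n} p = any p (allFin n)

degree : ∀ {n} → Graph n → Fin n → ℕ
degree {n} G v = sum (map (λ u → if G v u then 1 else 0) (allFin n))

-- Δ(H); the maximum over the empty vertex set is 0
maxDegree : ∀ {n} → Graph n → ℕ
maxDegree {n} G = foldr _⊔_ 0 (map (degree G) (allFin n))

deleteVertex : ∀ {n} → Graph (suc n) → Fin (suc n) → Graph n
deleteVertex G v x y = G (punchIn v x) (punchIn v y)

deleteEdge : ∀ {n} → Graph n → Fin n → Fin n → Graph n
deleteEdge G u v x y =
  G x y ∧ not ((x == u ∧ y == v) ∨ (x == v ∧ y == u))

-- contract the edge uv: v is merged into u; the remaining vertices are
-- relabelled via punchIn v.  Two distinct new vertices are adjacent iff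
-- some vertex of the first branch set is adjacent to some vertex of the
-- second (branch set of u is {u, v}, all others are singletons).
contract : ∀ {n} → Graph (suc n) → Fin (suc n) → Fin (suc n) → Graph n
contract G u v x y =
  not (x == y) ∧ anyFin (λ a → anyFin (λ b → inB x a ∧ inB y b ∧ G a b))
  where
    inB : _ → Fin _ → Bool
    inB w z = (z == punchIn v w) ∨ ((punchIn v w == u) ∧ (z == v))

data Minor : ∀ {m n} → Graph m → Graph n → Set where
  done     : ∀ {n} {G : Graph n} → Minor G G
  delVertex : ∀ {m n} {H : Graph m} {G : Graph (suc n)} (v : Fin (suc n)) →
              Minor H (deleteVertex G v) → Minor H G
  delEdge  : ∀ {m n} {H : Graph m} {G : Graph n} (u v : Fin n) →
             G u v ≡ true → Minor H (deleteEdge G u v) → Minor H G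
  contr    : ∀ {m n} {H : Graph m} {G : Graph (suc n)} (u v : Fin (suc n)) →
             G u v ≡ true → Minor H (contract G u v) → Minor H G

Dominating : ∀ {n} → Graph n → Subset n → Set
Dominating G S = ∀ v → v ∉ S → ∃[ u ] (u ∈ S × G u v ≡ true)

data PathIn {n} (G : Graph n) (S : Subset n) : Fin n → Fin n → Set where
  here : ∀ {x} → x ∈ S → PathIn G S x x
  step : ∀ {x w y} → x ∈ S → G x w ≡ true → PathIn G S w y → PathIn G S x y

InducedConnected : ∀ {n} → Graph n → Subset n → Set
InducedConnected G S = ∀ x y → x ∈ S → y ∈ S → PathIn G S x y

IsConnectedDominating : ∀ {n} → Graph n → Subset n → Set
IsConnectedDominating G S = Dominating G S × InducedConnected G S

-- γ_c(G) ≤ k  (with γ_c = ∞ when no connected dominating set exists):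
-- some connected dominating set has at most k elements.
γc≤ : ∀ {n} → Graph n → ℕ → Set
γc≤ G k = ∃[ S ] (IsConnectedDominating G S × ∣ S ∣ ≤ k)

{-# OPTIONS --safe #-}

-- Contracting a connected dominating set S into a single vertex, one edge of
-- G[S] at a time, leaves a vertex adjacent to all n − |S| others.
--
-- Conversely, let x be a vertex of maximum degree in a minor H, with connected
-- branch set B.  Every neighbour of x owns a vertex of the outer boundary
-- ∂B = N(B) ∖ B, so |∂B| ≥ n − k and the set R of vertices outside B ∪ N(B)
-- satisfies |B| + |R| ≤ k.  If some r ∈ R has no neighbour in ∂B, then r and
-- any b ∈ B are non-adjacent with no common neighbour, so {b, r} is a connected
-- dominating set of the complement.  Otherwise B together with one
-- ∂B-neighbour of each r ∈ R is a connected dominating set of G.  The case of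
-- a minor of the complement follows as complementing twice gives back G.

module Submission where

open import Defs
open import Data.Bool using (Bool; true; false; _∧_; _∨_; not; if_then_else_)
  renaming (_≟_ to _≟ᵇ_)
open import Data.Bool.Properties using (T-≡; ∨-zeroʳ; ¬-not)
open import Data.Fin using (Fin; zero; suc; punchIn; punchOut; _≟_)
open import Data.Fin.Properties
  using (any?; punchIn-injective; punchInᵢ≢i; punchIn-punchOut; punchOut-punchIn; punchOut-cong)
open import Data.Fin.Subset
  using (Subset; _∈_; _∉_; _⊆_; ∣_∣; ⁅_⁆; ∁; _∪_; _─_; Nonempty) renaming (⊥ to ∅)
open import Data.Fin.Subset.Properties
  using ( _∈?_; ∣p∣≤n; ∣∁p∣≡n∸∣p∣; ∣p─q∣≤∣p∣; ∣⁅x⁆∣≡1; ∣⊥∣≡0; x∈⁅x⁆; x∈⁅y⁆⇒x≡y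
        ; x∈p∪q⁺; x∈p∪q⁻; ∉⊥; nonempty?; Empty-unique; p⊆q⇒∣p∣≤∣q∣
        ; x∈∁p⇒x∉p; x∉p⇒x∈∁p; x∈p∧x∉q⇒x∈p─q; p─q⊆p; x∉⁅y⁆⇒x≢y)
import Data.List as List
open import Data.List using (allFin)
open import Data.List.Properties using (map-tabulate; foldr-preservesᵒ)
open import Data.List.Membership.Propositional using (lose)
open import Data.List.Membership.Propositional.Properties
  using (∈-allFin; ∈-map⁺; ∈-map⁻; foldr-selective)
open import Data.List.Relation.Unary.Any using (satisfied)
open import Data.List.Relation.Unary.Any.Properties using (any⁺; any⁻)
open import Data.Maybe using (Maybe; just; nothing; maybe′; _>>=_)
open import Data.Maybe.Properties using (just-injective) renaming (≡-dec to ≡ᵐ-dec)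
open import Data.Nat using (ℕ; zero; suc; _≤_; _<_; _+_; _∸_; _⊔_; z≤n; s≤s; _<?_)
open import Data.Nat.Properties
  using ( ≤-refl; ≤-trans; ≤-reflexive; +-suc; +-assoc; +-comm; +-mono-≤; +-monoʳ-≤; +-cancelˡ-≤
        ; ≮⇒≥; ≤-pred; 0∸n≡0; m∸n≤m; m+[n∸m]≡n; m≤n+m∸n; ⊔-sel; m≤n⇒m≤n⊔o; m≤n⇒m≤o⊔n
        ; module ≤-Reasoning)
open import Data.Nat.ListAction using (sum)
open import Data.Product using (∃-syntax; _×_; _,_; proj₁; proj₂; map₁; map₂)
open import Data.Sum using (_⊎_; inj₁; inj₂; [_,_])
import Data.Sum as Sum
open import Data.Vec using (Vec; []; _∷_; here; there; tabulate; lookup; removeAt)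
open import Data.Vec.Properties using (lookup∘tabulate; []=⇒lookup; lookup⇒[]=; removeAt-punchOut)
open import Function using (_∘_; id)
open import Function.Bundles using (Equivalence; _⇔_; mk⇔)
open import Relation.Binary.PropositionalEquality
  using (_≡_; _≢_; refl; sym; trans; cong; cong₂; subst; subst₂)
open import Relation.Nullary using (¬_; yes; no; does; contradiction)
open import Relation.Nullary.Decidable using (dec-true; dec-false; isYes≗does; _×-dec_; ¬?)
open import Relation.Unary using (Pred; Decidable)

private
  variable
    m n : ℕ

Symmetric : Graph n → Set
Symmetric {n} G = ∀ (u v : Fin n) → G u v ≡ G v u

Loopless : Graph n → Set
Loopless {n} G = ∀ (v : Fin n) → G v v ≡ false

≡⇒== : {x y : Fin n} → x ≡ y → x == y ≡ true
≡⇒== {x = x} {y} = trans (isYes≗does (x ≟ y)) ∘ dec-true (x ≟ y)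

≢⇒==false : {x y : Fin n} → x ≢ y → x == y ≡ false
≢⇒==false {x = x} {y} = trans (isYes≗does (x ≟ y)) ∘ dec-false (x ≟ y)

==⇒≡ : {x y : Fin n} → x == y ≡ true → x ≡ y
==⇒≡ {x = x} {y} x==y with x ≟ y
... | yes x≡y = x≡y

==-sym : (x y : Fin n) → x == y ≡ y == x
==-sym x y with x ≟ y
... | yes x≡y = sym (≡⇒== (sym x≡y))
... | no x≢y  = sym (≢⇒==false (x≢y ∘ sym))

∧≡true⇒ : ∀ {a b} → a ∧ b ≡ true → a ≡ true × b ≡ true
∧≡true⇒ {true} b≡true = refl , b≡true

∨-introˡ : ∀ {a b} → a ≡ true → a ∨ b ≡ true
∨-introˡ refl = refl

∨-introʳ : ∀ {a b} → b ≡ true → a ∨ b ≡ true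
∨-introʳ {a} refl = ∨-zeroʳ a

∨≡true⇒ : ∀ {a b} → a ∨ b ≡ true → a ≡ true ⊎ b ≡ true
∨≡true⇒ {true}  _        = inj₁ refl
∨≡true⇒ {false} b≡true = inj₂ b≡true

anyFin⁺ : {p : Fin n → Bool} (i : Fin n) → p i ≡ true → anyFin p ≡ true
anyFin⁺ {p = p} i pi≡true =
  Equivalence.to T-≡ (any⁺ p (lose (∈-allFin i) (Equivalence.from T-≡ pi≡true)))

anyFin⁻ : {p : Fin n → Bool} → anyFin p ≡ true → ∃[ i ] p i ≡ true
anyFin⁻ {p = p} any≡true =
  map₂ (Equivalence.to T-≡) (satisfied (any⁻ p (allFin _) (Equivalence.from T-≡ any≡true)))

∈-tabulate⁺ : {p : Fin n → Bool} {x : Fin n} → p x ≡ true → x ∈ tabulate p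
∈-tabulate⁺ {p = p} {x} px = lookup⇒[]= x (tabulate p) (trans (lookup∘tabulate p x) px)

∈-tabulate⁻ : {p : Fin n → Bool} {x : Fin n} → x ∈ tabulate p → p x ≡ true
∈-tabulate⁻ {p = p} {x} x∈ = trans (sym (lookup∘tabulate p x)) ([]=⇒lookup x∈)

select : ∀ {ℓ} {P : Pred (Fin n) ℓ} → Decidable P → Subset n
select P? = tabulate (does ∘ P?)

module _ {ℓ} {P : Pred (Fin n) ℓ} (P? : Decidable P) {x : Fin n} where

  ∈-select⁺ : P x → x ∈ select P?
  ∈-select⁺ px = ∈-tabulate⁺ (dec-true (P? x) px)

  ∈-select⁻ : x ∈ select P? → P x
  ∈-select⁻ x∈ with P? x | ∈-tabulate⁻ {p = does ∘ P?} x∈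
  ... | yes px | _ = px

∣p∣+∣q─p∣≡∣p∪q∣ : (p q : Subset n) → ∣ p ∣ + ∣ q ─ p ∣ ≡ ∣ p ∪ q ∣
∣p∣+∣q─p∣≡∣p∪q∣ []          []          = refl
∣p∣+∣q─p∣≡∣p∪q∣ (true ∷ p)  (_ ∷ q)     = cong suc (∣p∣+∣q─p∣≡∣p∪q∣ p q)
∣p∣+∣q─p∣≡∣p∪q∣ (false ∷ p) (true ∷ q)  = trans (+-suc ∣ p ∣ _) (cong suc (∣p∣+∣q─p∣≡∣p∪q∣ p q))
∣p∣+∣q─p∣≡∣p∪q∣ (false ∷ p) (false ∷ q) = ∣p∣+∣q─p∣≡∣p∪q∣ p q

∣p∪q∣≤∣p∣+∣q∣ : (p q : Subset n) → ∣ p ∪ q ∣ ≤ ∣ p ∣ + ∣ q ∣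
∣p∪q∣≤∣p∣+∣q∣ p q = begin
  ∣ p ∪ q ∣         ≡⟨ sym (∣p∣+∣q─p∣≡∣p∪q∣ p q) ⟩
  ∣ p ∣ + ∣ q ─ p ∣ ≤⟨ +-monoʳ-≤ ∣ p ∣ (∣p─q∣≤∣p∣ q p) ⟩
  ∣ p ∣ + ∣ q ∣     ∎
  where open ≤-Reasoning

partition-bound : ∀ {a b c n k} → a + b + c ≡ n → n ∸ k ≤ b → a + c ≤ k
partition-bound {a} {b} {c} {n} {k} a+b+c≡n n∸k≤b = +-cancelˡ-≤ b (a + c) k (begin
  b + (a + c) ≡⟨ sym (+-assoc b a c) ⟩
  b + a + c   ≡⟨ cong (_+ c) (+-comm b a) ⟩
  a + b + c   ≡⟨ a+b+c≡n ⟩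
  n           ≤⟨ m≤n+m∸n n k ⟩
  k + (n ∸ k) ≤⟨ +-monoʳ-≤ k n∸k≤b ⟩
  k + b       ≡⟨ +-comm k b ⟩
  b + k       ∎)
  where open ≤-Reasoning

∣p∣+∣∁p∣≡n : (p : Subset n) → ∣ p ∣ + ∣ ∁ p ∣ ≡ n
∣p∣+∣∁p∣≡n p = trans (cong (∣ p ∣ +_) (∣∁p∣≡n∸∣p∣ p)) (m+[n∸m]≡n (∣p∣≤n p))

x∈p⇒∣⁅x⁆∣≤∣p∣ : {p : Subset n} {x : Fin n} → x ∈ p → ∣ ⁅ x ⁆ ∣ ≤ ∣ p ∣
x∈p⇒∣⁅x⁆∣≤∣p∣ {x = x} x∈p = p⊆q⇒∣p∣≤∣q∣ λ y∈⁅x⁆ → subst (_∈ _) (sym (x∈⁅y⁆⇒x≡y x y∈⁅x⁆)) x∈p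

x∈p⇒0<∣p∣ : {p : Subset n} {x : Fin n} → x ∈ p → 0 < ∣ p ∣
x∈p⇒0<∣p∣ {x = x} x∈p = ≤-trans (≤-reflexive (sym (∣⁅x⁆∣≡1 x))) (x∈p⇒∣⁅x⁆∣≤∣p∣ x∈p)

0<∣p∣⇒Nonempty : (p : Subset n) → 0 < ∣ p ∣ → Nonempty p
0<∣p∣⇒Nonempty {n} p 0<∣p∣ with nonempty? p
... | yes ne = ne
... | no ¬ne with subst (0 <_) (∣⊥∣≡0 n) (subst (λ q → 0 < ∣ q ∣) (Empty-unique ¬ne) 0<∣p∣)
...   | ()

image : (Fin m → Maybe (Fin n)) → Subset m → Subset n
image f []          = ∅
image f (false ∷ p) = image (f ∘ suc) p
image f (true ∷ p)  = maybe′ ⁅_⁆ ∅ (f zero) ∪ image (f ∘ suc) p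

∣image∣≤∣p∣ : (f : Fin m → Maybe (Fin n)) (p : Subset m) → ∣ image f p ∣ ≤ ∣ p ∣
∣image∣≤∣p∣ {n = n} f []   = ≤-reflexive (∣⊥∣≡0 n)
∣image∣≤∣p∣ f (false ∷ p) = ∣image∣≤∣p∣ (f ∘ suc) p
∣image∣≤∣p∣ {n = n} f (true ∷ p) =
  ≤-trans (∣p∪q∣≤∣p∣+∣q∣ (maybe′ ⁅_⁆ ∅ (f zero)) (image (f ∘ suc) p))
          (+-mono-≤ (∣maybe⁅⁆∣≤1 (f zero)) (∣image∣≤∣p∣ (f ∘ suc) p))
  where
  ∣maybe⁅⁆∣≤1 : (y : Maybe (Fin n)) → ∣ maybe′ ⁅_⁆ ∅ y ∣ ≤ 1
  ∣maybe⁅⁆∣≤1 (just y) = ≤-reflexive (∣⁅x⁆∣≡1 y)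
  ∣maybe⁅⁆∣≤1 nothing  = ≤-trans (≤-reflexive (∣⊥∣≡0 n)) z≤n

∈-image⁺ : (f : Fin m → Maybe (Fin n)) {p : Subset m} {x : Fin m} {y : Fin n} →
           x ∈ p → f x ≡ just y → y ∈ image f p
∈-image⁺ f {true ∷ p}  here        fx≡y =
  x∈p∪q⁺ (inj₁ (subst (λ z → _ ∈ maybe′ ⁅_⁆ ∅ z) (sym fx≡y) (x∈⁅x⁆ _)))
∈-image⁺ f {true ∷ p}  (there x∈p) fx≡y = x∈p∪q⁺ (inj₂ (∈-image⁺ (f ∘ suc) x∈p fx≡y))
∈-image⁺ f {false ∷ p} (there x∈p) fx≡y = ∈-image⁺ (f ∘ suc) x∈p fx≡y

∈-image⁻ : (f : Fin m → Maybe (Fin n)) (p : Subset m) {y : Fin n} →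
           y ∈ image f p → ∃[ x ] (x ∈ p × f x ≡ just y)
∈-image⁻ f []          y∈ = contradiction y∈ ∉⊥
∈-image⁻ f (false ∷ p) y∈ with ∈-image⁻ (f ∘ suc) p y∈
... | x , x∈p , fx≡y = suc x , there x∈p , fx≡y
∈-image⁻ f (true ∷ p)  y∈ with x∈p∪q⁻ (maybe′ ⁅_⁆ ∅ (f zero)) _ y∈
... | inj₂ y∈rest with ∈-image⁻ (f ∘ suc) p y∈rest
...   | x , x∈p , fx≡y = suc x , there x∈p , fx≡y
∈-image⁻ f (true ∷ p)  y∈ | inj₁ y∈f0 with f zero in f0≡
... | just z  = zero , here , trans f0≡ (cong just (sym (x∈⁅y⁆⇒x≡y z y∈f0)))
... | nothing = contradiction y∈f0 ∉⊥

lookup-removeAt : ∀ {A : Set} (xs : Vec A (suc n)) i x →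
                  lookup (removeAt xs i) x ≡ lookup xs (punchIn i x)
lookup-removeAt xs i x =
  trans (cong (lookup (removeAt xs i)) (sym (punchOut-punchIn i)))
        (removeAt-punchOut xs (punchInᵢ≢i i x ∘ sym))

∈-removeAt⁺ : ∀ {p : Subset (suc n)} {i x} → punchIn i x ∈ p → x ∈ removeAt p i
∈-removeAt⁺ {p = p} {i} {x} x∈p =
  lookup⇒[]= x (removeAt p i) (trans (lookup-removeAt p i x) ([]=⇒lookup x∈p))

∈-removeAt⁻ : ∀ {p : Subset (suc n)} {i x} → x ∈ removeAt p i → punchIn i x ∈ p
∈-removeAt⁻ {p = p} {i} {x} x∈ =
  lookup⇒[]= (punchIn i x) p (trans (sym (lookup-removeAt p i x)) ([]=⇒lookup x∈))

∣removeAt∣<∣p∣ : (p : Subset (suc n)) {i : Fin (suc n)} → i ∈ p → ∣ removeAt p i ∣ < ∣ p ∣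
∣removeAt∣<∣p∣ (true ∷ p)          here        = ≤-refl
∣removeAt∣<∣p∣ (true ∷ p@(_ ∷ _))  (there i∈p) = s≤s (∣removeAt∣<∣p∣ p i∈p)
∣removeAt∣<∣p∣ (false ∷ p@(_ ∷ _)) (there i∈p) = ∣removeAt∣<∣p∣ p i∈p

neighbours : Graph n → Fin n → Subset n
neighbours G v = tabulate (G v)

sum-indicator≡∣tabulate∣ : (p : Fin n → Bool) →
  sum (List.tabulate (λ u → if p u then 1 else 0)) ≡ ∣ tabulate p ∣
sum-indicator≡∣tabulate∣ {zero}  p = refl
sum-indicator≡∣tabulate∣ {suc n} p with p zero
... | true  = cong suc (sum-indicator≡∣tabulate∣ (p ∘ suc))
... | false = sum-indicator≡∣tabulate∣ (p ∘ suc)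

degree≡∣neighbours∣ : (G : Graph n) (v : Fin n) → degree G v ≡ ∣ neighbours G v ∣
degree≡∣neighbours∣ G v =
  trans (cong sum (map-tabulate id (λ u → if G v u then 1 else 0))) (sum-indicator≡∣tabulate∣ (G v))

degree≤maxDegree : (G : Graph n) (v : Fin n) → degree G v ≤ maxDegree G
degree≤maxDegree G v = foldr-preservesᵒ ⊔-preserves-≤ 0 _
  (inj₂ (lose (∈-map⁺ (degree G) (∈-allFin v)) ≤-refl))
  where
  ⊔-preserves-≤ : ∀ x y → degree G v ≤ x ⊎ degree G v ≤ y → degree G v ≤ x ⊔ y
  ⊔-preserves-≤ x y = [ m≤n⇒m≤n⊔o y , m≤n⇒m≤o⊔n x ]

≤maxDegree⇒≤degree : ∀ {d} (G : Graph n) → 0 < d → d ≤ maxDegree G → ∃[ v ] d ≤ degree G v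
≤maxDegree⇒≤degree G 0<d d≤Δ with foldr-selective ⊔-sel 0 (List.map (degree G) (allFin _))
... | inj₁ Δ≡0 = contradiction (≤-trans 0<d (≤-trans d≤Δ (≤-reflexive Δ≡0))) λ ()
... | inj₂ Δ∈  with ∈-map⁻ (degree G) Δ∈
...   | v , _ , Δ≡deg = v , ≤-trans d≤Δ (≤-reflexive Δ≡deg)

undirected : Graph n → Graph n
undirected G x y = G x y ∨ G y x

undirected⁺ˡ : (G : Graph n) {x y : Fin n} → G x y ≡ true → undirected G x y ≡ true
undirected⁺ˡ G = ∨-introˡ

undirected⁺ʳ : (G : Graph n) {x y : Fin n} → G y x ≡ true → undirected G x y ≡ true
undirected⁺ʳ G {x} = ∨-introʳ {G x _}

undirected-symmetric : {G : Graph n} → Symmetric G → ∀ {x y} → undirected G x y ≡ true → G x y ≡ true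
undirected-symmetric sym-G {x} {y} xy with ∨≡true⇒ xy
... | inj₁ G-xy = G-xy
... | inj₂ G-yx = trans (sym-G x y) G-yx

module _ {G : Graph n} {S : Subset n} where

  PathIn-source : ∀ {a b} → PathIn G S a b → a ∈ S
  PathIn-source (here a∈S)     = a∈S
  PathIn-source (step a∈S _ _) = a∈S

  PathIn-++ : ∀ {a b c} → PathIn G S a b → PathIn G S b c → PathIn G S a c
  PathIn-++ (here _)          q = q
  PathIn-++ (step a∈S ab rest) q = step a∈S ab (PathIn-++ rest q)

  PathIn-distinct-edge : ∀ {a b} → PathIn G S a b → a ≢ b →
    ∃[ c ] ∃[ e ] (c ∈ S × e ∈ S × c ≢ e × G c e ≡ true)
  PathIn-distinct-edge (here _) a≢a = contradiction refl a≢a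
  PathIn-distinct-edge (step {x} {w} x∈S xw rest) x≢b with x ≟ w
  ... | yes refl = PathIn-distinct-edge rest x≢b
  ... | no x≢w   = x , w , x∈S , PathIn-source rest , x≢w , xw

  PathIn-map : {G′ : Graph m} {S′ : Subset m} (f : Fin n → Fin m) →
    (∀ {c} → c ∈ S → f c ∈ S′) →
    (∀ {c e} → G c e ≡ true → f c ≢ f e → G′ (f c) (f e) ≡ true) →
    ∀ {a b} → PathIn G S a b → PathIn G′ S′ (f a) (f b)
  PathIn-map f S→S′ G→G′ (here a∈S) = here (S→S′ a∈S)
  PathIn-map {G′ = G′} {S′} f S→S′ G→G′ (step {x} {w} {y} x∈S xw rest) with f x ≟ f w
  ... | yes fx≡fw = subst (λ z → PathIn G′ S′ z (f y)) (sym fx≡fw) (PathIn-map f S→S′ G→G′ rest)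
  ... | no fx≢fw  = step (S→S′ x∈S) (G→G′ xw fx≢fw) (PathIn-map f S→S′ G→G′ rest)

  PathIn-mono : {G′ : Graph n} {S′ : Subset n} → (∀ {x y} → G x y ≡ true → G′ x y ≡ true) → S ⊆ S′ →
    ∀ {a b} → PathIn G S a b → PathIn G′ S′ a b
  PathIn-mono G⊆G′ S⊆S′ = PathIn-map id S⊆S′ (λ e _ → G⊆G′ e)

⁅x⁆-connected : (G : Graph n) (x : Fin n) → InducedConnected G ⁅ x ⁆
⁅x⁆-connected G x a b a∈ b∈ with x∈⁅y⁆⇒x≡y x a∈ | x∈⁅y⁆⇒x≡y x b∈
... | refl | refl = here a∈

-- Minor models

>>=-just⁺ : ∀ {A B : Set} {ma : Maybe A} {f : A → Maybe B} {x y} →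
            ma ≡ just x → f x ≡ just y → (ma >>= f) ≡ just y
>>=-just⁺ refl fx≡y = fx≡y

>>=-just⁻ : ∀ {A B : Set} {ma : Maybe A} {f : A → Maybe B} {y} →
            (ma >>= f) ≡ just y → ∃[ x ] (ma ≡ just x × f x ≡ just y)
>>=-just⁻ {ma = just x} fx≡y = x , refl , fx≡y

fibre : (Fin n → Maybe (Fin m)) → Fin m → Subset n
fibre φ x = select (λ a → ≡ᵐ-dec _≟_ (φ a) (just x))

module _ (φ : Fin n → Maybe (Fin m)) {a : Fin n} {x : Fin m} where

  ∈-fibre⁺ : φ a ≡ just x → a ∈ fibre φ x
  ∈-fibre⁺ = ∈-select⁺ (λ b → ≡ᵐ-dec _≟_ (φ b) (just x))

  ∈-fibre⁻ : a ∈ fibre φ x → φ a ≡ just x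
  ∈-fibre⁻ = ∈-select⁻ (λ b → ≡ᵐ-dec _≟_ (φ b) (just x))

-- φ sends each vertex of G to the vertex of H whose branch set contains it
-- (nothing for deleted vertices), so branch sets are the fibres of φ.  They are
-- connected along edges of either direction, since the graphs met along a
-- sequence of minor operations need not be symmetric.
record Model (H : Graph m) (G : Graph n) : Set where
  field
    φ         : Fin n → Maybe (Fin m)
    connected : ∀ {x a b} → φ a ≡ just x → φ b ≡ just x → PathIn (undirected G) (fibre φ x) a b
    realises  : ∀ {x y} → H x y ≡ true → ∃[ a ] ∃[ b ] (φ a ≡ just x × φ b ≡ just y × G a b ≡ true)

  realisesᵘ : ∀ {x y} → undirected H x y ≡ true →
              ∃[ a ] ∃[ b ] (φ a ≡ just x × φ b ≡ just y × undirected G a b ≡ true)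
  realisesᵘ xy with ∨≡true⇒ xy
  ... | inj₁ H-xy with realises H-xy
  ...   | a , b , a↦x , b↦y , ab = a , b , a↦x , b↦y , undirected⁺ˡ G ab
  realisesᵘ xy | inj₂ H-yx with realises H-yx
  ...   | b , a , b↦y , a↦x , ba = a , b , a↦x , b↦y , undirected⁺ʳ G ba

_∘ᴹ_ : ∀ {k} {H : Graph m} {G₁ : Graph k} {G : Graph n} → Model H G₁ → Model G₁ G → Model H G
_∘ᴹ_ {m = m} {n = n} {H = H} {G₁} {G} M₁ M₂ =
  record { φ = φ ; connected = connected ; realises = realises }
  where
  module M₁ = Model M₁
  module M₂ = Model M₂

  φ : Fin n → Maybe (Fin m)
  φ a = M₂.φ a >>= M₁.φ

  fibre⊆ : ∀ {a′ x} → M₁.φ a′ ≡ just x → fibre M₂.φ a′ ⊆ fibre φ x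
  fibre⊆ a′↦x c∈ = ∈-fibre⁺ φ (>>=-just⁺ (∈-fibre⁻ M₂.φ c∈) a′↦x)

  lift : ∀ {x a′ b′ a b} → PathIn (undirected G₁) (fibre M₁.φ x) a′ b′ →
         M₂.φ a ≡ just a′ → M₂.φ b ≡ just b′ → PathIn (undirected G) (fibre φ x) a b
  lift (here a′∈) a↦a′ b↦b′ = PathIn-mono id (fibre⊆ (∈-fibre⁻ M₁.φ a′∈)) (M₂.connected a↦a′ b↦b′)
  lift (step a′∈ a′w′ rest) a↦a′ b↦b′ with M₂.realisesᵘ a′w′
  ... | c , d , c↦a′ , d↦w′ , cd =
    PathIn-++ (PathIn-mono id (fibre⊆ (∈-fibre⁻ M₁.φ a′∈)) (M₂.connected a↦a′ c↦a′))
              (step (fibre⊆ (∈-fibre⁻ M₁.φ a′∈) (∈-fibre⁺ M₂.φ c↦a′)) cd (lift rest d↦w′ b↦b′))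

  connected : ∀ {x a b} → φ a ≡ just x → φ b ≡ just x → PathIn (undirected G) (fibre φ x) a b
  connected a↦x b↦x with >>=-just⁻ {ma = M₂.φ _} a↦x | >>=-just⁻ {ma = M₂.φ _} b↦x
  ... | a′ , a↦a′ , a′↦x | b′ , b↦b′ , b′↦x = lift (M₁.connected a′↦x b′↦x) a↦a′ b↦b′

  realises : ∀ {x y} → H x y ≡ true → ∃[ a ] ∃[ b ] (φ a ≡ just x × φ b ≡ just y × G a b ≡ true)
  realises xy with M₁.realises xy
  ... | a′ , b′ , a′↦x , b′↦y , a′b′ with M₂.realises a′b′
  ...   | a , b , a↦a′ , b↦b′ , ab = a , b , >>=-just⁺ a↦a′ a′↦x , >>=-just⁺ b↦b′ b′↦y , ab

subgraph-model : {H G : Graph n} → (∀ {x y} → H x y ≡ true → G x y ≡ true) → Model H G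
subgraph-model H⊆G = record
  { φ         = just
  ; connected = λ { refl refl → here (∈-fibre⁺ just refl) }
  ; realises  = λ xy → _ , _ , refl , refl , H⊆G xy
  }

-- the partial inverse of punchIn v
puncture : Fin (suc n) → Fin (suc n) → Maybe (Fin n)
puncture v a with v ≟ a
... | yes _   = nothing
... | no v≢a  = just (punchOut v≢a)

puncture-punchIn : (v : Fin (suc n)) (x : Fin n) → puncture v (punchIn v x) ≡ just x
puncture-punchIn v x with v ≟ punchIn v x
... | yes v≡ = contradiction (sym v≡) (punchInᵢ≢i v x)
... | no _   = cong just (trans (punchOut-cong v refl) (punchOut-punchIn v))

puncture⇒punchIn : (v : Fin (suc n)) {a : Fin (suc n)} {x : Fin n} →
                   puncture v a ≡ just x → a ≡ punchIn v x
puncture⇒punchIn v {a} a↦x with v ≟ a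
... | no v≢a = trans (sym (punchIn-punchOut v≢a)) (cong (punchIn v) (just-injective a↦x))

deleteVertex-model : (G : Graph (suc n)) (v : Fin (suc n)) → Model (deleteVertex G v) G
deleteVertex-model G v = record
  { φ         = puncture v
  ; connected = connected
  ; realises  = λ {x} {y} xy →
      punchIn v x , punchIn v y , puncture-punchIn v x , puncture-punchIn v y , xy
  }
  where
  connected : ∀ {x a b} → puncture v a ≡ just x → puncture v b ≡ just x →
              PathIn (undirected G) (fibre (puncture v) x) a b
  connected a↦x b↦x with puncture⇒punchIn v a↦x | puncture⇒punchIn v b↦x
  ... | refl | refl = here (∈-fibre⁺ (puncture v) a↦x)

-- The vertices of contract G u w are those of G with w identified with u,
-- renumbered by punchOut w; merge is this quotient map, and inBranch x is the
-- branch set of x used in the definition of contract.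
module Contraction {n} (u w : Fin (suc n)) (u≢w : u ≢ w) where

  merge : Fin (suc n) → Fin n
  merge a with w ≟ a
  ... | yes _  = punchOut (u≢w ∘ sym)
  ... | no w≢a = punchOut w≢a

  punchIn-merge : ∀ {a} → a ≢ w → punchIn w (merge a) ≡ a
  punchIn-merge {a} a≢w with w ≟ a
  ... | yes w≡a = contradiction (sym w≡a) a≢w
  ... | no w≢a  = punchIn-punchOut w≢a

  punchIn-merge-w : punchIn w (merge w) ≡ u
  punchIn-merge-w with w ≟ w
  ... | yes _  = punchIn-punchOut (u≢w ∘ sym)
  ... | no w≢w = contradiction refl w≢w

  merge-punchIn : ∀ x → merge (punchIn w x) ≡ x
  merge-punchIn x = punchIn-injective w _ _ (punchIn-merge (punchInᵢ≢i w x))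

  merge-injective : ∀ {a b} → a ≢ w → b ≢ w → merge a ≡ merge b → a ≡ b
  merge-injective a≢w b≢w ma≡mb =
    trans (sym (punchIn-merge a≢w)) (trans (cong (punchIn w) ma≡mb) (punchIn-merge b≢w))

  merge≡merge-w : ∀ {a} → a ≢ w → merge a ≡ merge w → a ≡ u
  merge≡merge-w a≢w ma≡mw =
    trans (sym (punchIn-merge a≢w)) (trans (cong (punchIn w) ma≡mw) punchIn-merge-w)

  inBranch : Fin n → Fin (suc n) → Bool
  inBranch x a = (a == punchIn w x) ∨ ((punchIn w x == u) ∧ (a == w))

  inBranch-merge : ∀ a → inBranch (merge a) a ≡ true
  inBranch-merge a with a ≟ w
  ... | yes refl = ∨-introʳ (cong₂ _∧_ (≡⇒== punchIn-merge-w) refl)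
  ... | no a≢w   = ∨-introˡ (≡⇒== (sym (punchIn-merge a≢w)))

  inBranch⇒merge : ∀ {x a} → inBranch x a ≡ true → merge a ≡ x
  inBranch⇒merge {x} {a} x∋a with ∨≡true⇒ x∋a
  ... | inj₁ a==p = subst (λ z → merge z ≡ x) (sym (==⇒≡ a==p)) (merge-punchIn x)
  ... | inj₂ x∋w with ∧≡true⇒ {punchIn w x == u} x∋w
  ...   | p==u , a==w rewrite ==⇒≡ a==w =
    punchIn-injective w _ _ (trans punchIn-merge-w (sym (==⇒≡ p==u)))

  module _ (G : Graph (suc n)) where

    contract-edge⁻ : ∀ {x y} → contract G u w x y ≡ true →
                     ∃[ a ] ∃[ b ] (merge a ≡ x × merge b ≡ y × G a b ≡ true)
    contract-edge⁻ xy with anyFin⁻ (proj₂ (∧≡true⇒ xy))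
    ... | a , ∃b with anyFin⁻ ∃b
    ...   | b , x∋a∧y∋b∧ab with ∧≡true⇒ x∋a∧y∋b∧ab
    ...     | x∋a , y∋b∧ab with ∧≡true⇒ y∋b∧ab
    ...       | y∋b , ab = a , b , inBranch⇒merge x∋a , inBranch⇒merge y∋b , ab

    contract-edge⁺ : ∀ {a b} → G a b ≡ true → merge a ≢ merge b →
                     contract G u w (merge a) (merge b) ≡ true
    contract-edge⁺ {a} {b} ab ma≢mb =
      cong₂ _∧_ (cong not (≢⇒==false ma≢mb))
                (anyFin⁺ a (anyFin⁺ b (cong₂ _∧_ (inBranch-merge a)
                                                 (cong₂ _∧_ (inBranch-merge b) ab))))

    contract-model : G u w ≡ true → Model (contract G u w) G
    contract-model uw = record
      { φ         = just ∘ merge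
      ; connected = λ a↦x b↦x → fibre-path (just-injective a↦x) (just-injective b↦x)
      ; realises  = realises
      }
      where
      fibre-path : ∀ {x a b} → merge a ≡ x → merge b ≡ x →
                   PathIn (undirected G) (fibre (just ∘ merge) x) a b
      fibre-path {x} {a} {b} a↦x b↦x with a ≟ w | b ≟ w
      ... | yes refl | yes refl = here (∈-fibre⁺ (just ∘ merge) (cong just a↦x))
      ... | yes refl | no b≢w with merge≡merge-w b≢w (trans b↦x (sym a↦x))
      ...   | refl = step (∈-fibre⁺ (just ∘ merge) (cong just a↦x)) (undirected⁺ʳ G uw)
                          (here (∈-fibre⁺ (just ∘ merge) (cong just b↦x)))
      fibre-path a↦x b↦x | no a≢w | yes refl with merge≡merge-w a≢w (trans a↦x (sym b↦x))
      ...   | refl = step (∈-fibre⁺ (just ∘ merge) (cong just a↦x)) (undirected⁺ˡ G uw)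
                          (here (∈-fibre⁺ (just ∘ merge) (cong just b↦x)))
      fibre-path a↦x b↦x | no a≢w | no b≢w with merge-injective a≢w b≢w (trans a↦x (sym b↦x))
      ...   | refl = here (∈-fibre⁺ (just ∘ merge) (cong just b↦x))

      realises : ∀ {x y} → contract G u w x y ≡ true →
                 ∃[ a ] ∃[ b ] (just (merge a) ≡ just x × just (merge b) ≡ just y × G a b ≡ true)
      realises xy with contract-edge⁻ xy
      ... | a , b , a↦x , b↦y , ab = a , b , cong just a↦x , cong just b↦y , ab

adjacent⇒≢ : {G : Graph n} → Loopless G → ∀ {u v} → G u v ≡ true → u ≢ v
adjacent⇒≢ loopless {u} uv refl with trans (sym uv) (loopless u)
... | ()

deleteEdge-loopless : (G : Graph n) → Loopless G → ∀ u v → Loopless (deleteEdge G u v)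
deleteEdge-loopless G loopless u v x rewrite loopless x = refl

contract-loopless : (G : Graph (suc n)) (u v : Fin (suc n)) → Loopless (contract G u v)
contract-loopless G u v x rewrite ≡⇒== {x = x} refl = refl

minor-loopless : {H : Graph m} {G : Graph n} → Minor H G → Loopless G → Loopless H
minor-loopless done                 loopless = loopless
minor-loopless (delVertex v H≼G)    loopless = minor-loopless H≼G (loopless ∘ punchIn v)
minor-loopless {G = G} (delEdge u v _ H≼G) loopless =
  minor-loopless H≼G (deleteEdge-loopless G loopless u v)
minor-loopless (contr u v _ H≼G)    _        = minor-loopless H≼G (contract-loopless _ u v)

minor⇒model : {H : Graph m} {G : Graph n} → Loopless G → Minor H G → Model H G
minor⇒model _        done = subgraph-model id
minor⇒model loopless (delVertex v H≼G) =
  minor⇒model (loopless ∘ punchIn v) H≼G ∘ᴹ deleteVertex-model _ v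
minor⇒model {G = G} loopless (delEdge u v _ H≼G) =
  minor⇒model (deleteEdge-loopless G loopless u v) H≼G ∘ᴹ subgraph-model (proj₁ ∘ ∧≡true⇒)
minor⇒model loopless (contr u v uv H≼G) =
  minor⇒model (contract-loopless _ u v) H≼G
    ∘ᴹ Contraction.contract-model u v (adjacent⇒≢ loopless uv) _ uv

complement-edge : (G : Graph n) {x y : Fin n} → x ≢ y → G x y ≡ false → complement G x y ≡ true
complement-edge G x≢y xy rewrite ≢⇒==false x≢y | xy = refl

complement-simple : {G : Graph n} → IsSimple G → IsSimple (complement G)
complement-simple (sym-G , _) =
  (λ u v → cong₂ (λ p q → not p ∧ not q) (==-sym u v) (sym-G u v)) ,
  (λ v → cong (λ p → not p ∧ _) (≡⇒== {x = v} refl))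

complement-involutive⊆ : (G : Graph n) {x y : Fin n} → complement (complement G) x y ≡ true → G x y ≡ true
complement-involutive⊆ G {x} {y} e with x == y | G x y | e
... | false | true | _ = refl

γc≤-mono : {G G′ : Graph n} → (∀ {x y} → G x y ≡ true → G′ x y ≡ true) → ∀ {k} → γc≤ G k → γc≤ G′ k
γc≤-mono G⊆G′ (S , (dominating , connected) , size) =
  S , ((λ v v∉S → map₂ (map₂ G⊆G′) (dominating v v∉S)) ,
       (λ x y x∈S y∈S → PathIn-mono G⊆G′ id (connected x y x∈S y∈S))) , size

-- From a large-degree minor to a connected dominating set

MinorWithMaxDegree≥ : Graph n → ℕ → Set
MinorWithMaxDegree≥ G d = ∃[ m ] ∃[ H ] (Minor {m} H G × d ≤ maxDegree H)

witness : ∀ {ℓ} {P : Pred (Fin n) ℓ} → Decidable P → Maybe (Fin n)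
witness P? with any? P?
... | yes (i , _) = just i
... | no _        = nothing

module _ {ℓ} {P : Pred (Fin n) ℓ} (P? : Decidable P) where

  witness-just : ∀ {i} → witness P? ≡ just i → P i
  witness-just wit≡i with any? P?
  witness-just refl | yes (_ , Pi) = Pi

  witness-nothing : witness P? ≡ nothing → ∀ i → ¬ P i
  witness-nothing wit≡nothing i Pi with any? P?
  ... | no ¬∃P = ¬∃P (i , Pi)

neighbourhood : Graph n → Subset n → Subset n
neighbourhood G B = select (λ a → any? (λ b → b ∈? B ×-dec G b a ≟ᵇ true))

boundary : Graph n → Subset n → Subset n
boundary G B = neighbourhood G B ─ B

module _ (G : Graph n) (B : Subset n) {a : Fin n} where

  ∈-neighbourhood⁺ : ∀ {b} → b ∈ B → G b a ≡ true → a ∈ neighbourhood G B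
  ∈-neighbourhood⁺ {b} b∈B ba =
    ∈-select⁺ (λ a → any? (λ b → b ∈? B ×-dec G b a ≟ᵇ true)) (b , b∈B , ba)

  ∈-neighbourhood⁻ : a ∈ neighbourhood G B → ∃[ b ] (b ∈ B × G b a ≡ true)
  ∈-neighbourhood⁻ = ∈-select⁻ (λ a → any? (λ b → b ∈? B ×-dec G b a ≟ᵇ true))

boundary-partition : (G : Graph n) (B : Subset n) →
  ∣ B ∣ + ∣ boundary G B ∣ + ∣ ∁ (B ∪ neighbourhood G B) ∣ ≡ n
boundary-partition G B =
  trans (cong (_+ ∣ ∁ (B ∪ neighbourhood G B) ∣) (∣p∣+∣q─p∣≡∣p∪q∣ B (neighbourhood G B)))
        (∣p∣+∣∁p∣≡n (B ∪ neighbourhood G B))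

nonadjacent-pair-CDS : {G : Graph n} → Symmetric G → ∀ {b u} → b ≢ u → G b u ≡ false →
  (∀ {v} → G b v ≡ true → G u v ≡ false) → IsConnectedDominating (complement G) (⁅ b ⁆ ∪ ⁅ u ⁆)
nonadjacent-pair-CDS {G = G} sym-G {b} {u} b≢u bu no-common = dominating , connected
  where
  b∈S : b ∈ ⁅ b ⁆ ∪ ⁅ u ⁆
  b∈S = x∈p∪q⁺ (inj₁ (x∈⁅x⁆ b))

  u∈S : u ∈ ⁅ b ⁆ ∪ ⁅ u ⁆
  u∈S = x∈p∪q⁺ (inj₂ (x∈⁅x⁆ u))

  dominating : Dominating (complement G) (⁅ b ⁆ ∪ ⁅ u ⁆)
  dominating v v∉S with G b v in bv
  ... | false = b , b∈S , complement-edge G (λ { refl → v∉S b∈S }) bv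
  ... | true  = u , u∈S , complement-edge G (λ { refl → v∉S u∈S }) (no-common bv)

  connected : InducedConnected (complement G) (⁅ b ⁆ ∪ ⁅ u ⁆)
  connected x y x∈S y∈S with x∈p∪q⁻ ⁅ b ⁆ ⁅ u ⁆ x∈S | x∈p∪q⁻ ⁅ b ⁆ ⁅ u ⁆ y∈S
  ... | inj₁ x∈⁅b⁆ | inj₁ y∈⁅b⁆ rewrite x∈⁅y⁆⇒x≡y b x∈⁅b⁆ | x∈⁅y⁆⇒x≡y b y∈⁅b⁆ = here b∈S
  ... | inj₂ x∈⁅u⁆ | inj₂ y∈⁅u⁆ rewrite x∈⁅y⁆⇒x≡y u x∈⁅u⁆ | x∈⁅y⁆⇒x≡y u y∈⁅u⁆ = here u∈S
  ... | inj₁ x∈⁅b⁆ | inj₂ y∈⁅u⁆ rewrite x∈⁅y⁆⇒x≡y b x∈⁅b⁆ | x∈⁅y⁆⇒x≡y u y∈⁅u⁆ =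
    step b∈S (complement-edge G b≢u bu) (here u∈S)
  ... | inj₂ x∈⁅u⁆ | inj₁ y∈⁅b⁆ rewrite x∈⁅y⁆⇒x≡y u x∈⁅u⁆ | x∈⁅y⁆⇒x≡y b y∈⁅b⁆ =
    step u∈S (complement-edge G (b≢u ∘ sym) (trans (sym-G u b) bu)) (here b∈S)

connected-extension : {G : Graph n} → Symmetric G → ∀ {B S} → InducedConnected G B →
  B ⊆ S → S ⊆ B ∪ neighbourhood G B → InducedConnected G S
connected-extension {G = G} sym-G {B} {S} B-connected B⊆S S⊆B∪N x y x∈S y∈S
  with anchor x∈S | anchor y∈S
  where
  anchor : ∀ {s} → s ∈ S → ∃[ b ] (b ∈ B × PathIn G S s b × PathIn G S b s)
  anchor {s} s∈S with x∈p∪q⁻ B (neighbourhood G B) (S⊆B∪N s∈S)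
  ... | inj₁ s∈B = s , s∈B , here s∈S , here s∈S
  ... | inj₂ s∈N with ∈-neighbourhood⁻ G B s∈N
  ...   | b , b∈B , bs =
    b , b∈B , step s∈S (trans (sym-G s b) bs) (here (B⊆S b∈B)) , step (B⊆S b∈B) bs (here s∈S)
... | bx , bx∈B , x→bx , _ | by , by∈B , _ , by→y =
  PathIn-++ x→bx (PathIn-++ (PathIn-mono id B⊆S (B-connected bx by bx∈B by∈B)) by→y)

module ConnectedSet {G : Graph n} (sym-G : Symmetric G) {B : Subset n} {b₀ : Fin n} (b₀∈B : b₀ ∈ B)
                   (B-connected : InducedConnected G B) where

  N R : Subset n
  N = neighbourhood G B
  R = ∁ (B ∪ N)

  ∂B? : (v : Fin n) → Decidable (λ w → w ∈ boundary G B × G w v ≡ true)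
  ∂B? v w = w ∈? boundary G B ×-dec G w v ≟ᵇ true

  attach : Fin n → Maybe (Fin n)
  attach v = witness (∂B? v)

  ∉B∪N⇒∈R : ∀ {v} → v ∉ B → v ∉ N → v ∈ R
  ∉B∪N⇒∈R v∉B v∉N = x∉p⇒x∈∁p ([ v∉B , v∉N ] ∘ x∈p∪q⁻ B N)

  ∈R⇒∉B : ∀ {v} → v ∈ R → v ∉ B
  ∈R⇒∉B v∈R v∈B = x∈∁p⇒x∉p v∈R (x∈p∪q⁺ (inj₁ v∈B))

  ∈R⇒∉N : ∀ {v} → v ∈ R → v ∉ N
  ∈R⇒∉N v∈R v∈N = x∈∁p⇒x∉p v∈R (x∈p∪q⁺ (inj₂ v∈N))

  unattached⇒complement-CDS : ∀ {u} → u ∈ R → attach u ≡ nothing →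
    IsConnectedDominating (complement G) (⁅ b₀ ⁆ ∪ ⁅ u ⁆)
  unattached⇒complement-CDS {u} u∈R u↦nothing =
    nonadjacent-pair-CDS sym-G (λ { refl → ∈R⇒∉B u∈R b₀∈B })
      (¬-not (∈R⇒∉N u∈R ∘ ∈-neighbourhood⁺ G B b₀∈B)) no-common-neighbour
    where
    no-common-neighbour : ∀ {v} → G b₀ v ≡ true → G u v ≡ false
    no-common-neighbour {v} b₀v = ¬-not u≁v
      where
      u≁v : G u v ≢ true
      u≁v uv with v ∈? B
      ... | yes v∈B = ∈R⇒∉N u∈R (∈-neighbourhood⁺ G B v∈B (trans (sym-G v u) uv))
      ... | no v∉B  = witness-nothing (∂B? u) u↦nothing v
        (x∈p∧x∉q⇒x∈p─q (∈-neighbourhood⁺ G B b₀∈B b₀v) v∉B , trans (sym-G v u) uv)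

  attached⇒CDS : (∀ {u} → u ∈ R → attach u ≢ nothing) → IsConnectedDominating G (B ∪ image attach R)
  attached⇒CDS all-attached = dominating , connected-extension sym-G B-connected B⊆S S⊆B∪N
    where
    S : Subset n
    S = B ∪ image attach R

    B⊆S : B ⊆ S
    B⊆S b∈B = x∈p∪q⁺ (inj₁ b∈B)

    S⊆B∪N : S ⊆ B ∪ N
    S⊆B∪N s∈S with x∈p∪q⁻ B (image attach R) s∈S
    ... | inj₁ s∈B = x∈p∪q⁺ (inj₁ s∈B)
    ... | inj₂ s∈W with ∈-image⁻ attach R s∈W
    ...   | u , _ , u↦s = x∈p∪q⁺ (inj₂ (p─q⊆p N B (proj₁ (witness-just (∂B? u) u↦s))))

    dominating : Dominating G S
    dominating v v∉S with v ∈? N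
    ... | yes v∈N = map₂ (map₁ B⊆S) (∈-neighbourhood⁻ G B v∈N)
    ... | no v∉N with attach v in v↦
    ...   | just w  = w , x∈p∪q⁺ (inj₂ (∈-image⁺ attach (∉B∪N⇒∈R (v∉S ∘ B⊆S) v∉N) v↦)) ,
                      proj₂ (witness-just (∂B? v) v↦)
    ...   | nothing = contradiction v↦ (all-attached (∉B∪N⇒∈R (v∉S ∘ B⊆S) v∉N))

  ∣B∣+∣R∣≤k : ∀ {k} → n ∸ k ≤ ∣ boundary G B ∣ → ∣ B ∣ + ∣ R ∣ ≤ k
  ∣B∣+∣R∣≤k = partition-bound {∣ B ∣} {c = ∣ R ∣} (boundary-partition G B)

  ∣⁅b₀⁆∪⁅u⁆∣≤∣B∣+∣R∣ : ∀ {u} → u ∈ R → ∣ ⁅ b₀ ⁆ ∪ ⁅ u ⁆ ∣ ≤ ∣ B ∣ + ∣ R ∣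
  ∣⁅b₀⁆∪⁅u⁆∣≤∣B∣+∣R∣ {u} u∈R =
    ≤-trans (∣p∪q∣≤∣p∣+∣q∣ ⁅ b₀ ⁆ ⁅ u ⁆) (+-mono-≤ (x∈p⇒∣⁅x⁆∣≤∣p∣ b₀∈B) (x∈p⇒∣⁅x⁆∣≤∣p∣ u∈R))

  ∣B∪attach[R]∣≤∣B∣+∣R∣ : ∣ B ∪ image attach R ∣ ≤ ∣ B ∣ + ∣ R ∣
  ∣B∪attach[R]∣≤∣B∣+∣R∣ =
    ≤-trans (∣p∪q∣≤∣p∣+∣q∣ B (image attach R)) (+-monoʳ-≤ ∣ B ∣ (∣image∣≤∣p∣ attach R))

  large-boundary⇒γc≤ : ∀ {k} → n ∸ k ≤ ∣ boundary G B ∣ → γc≤ G k ⊎ γc≤ (complement G) k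
  large-boundary⇒γc≤ n∸k≤∣∂B∣ with any? (λ u → u ∈? R ×-dec ≡ᵐ-dec _≟_ (attach u) nothing)
  ... | yes (u , u∈R , u↦nothing) = inj₂ (⁅ b₀ ⁆ ∪ ⁅ u ⁆ , unattached⇒complement-CDS u∈R u↦nothing ,
                                          ≤-trans (∣⁅b₀⁆∪⁅u⁆∣≤∣B∣+∣R∣ u∈R) (∣B∣+∣R∣≤k n∸k≤∣∂B∣))
  ... | no ¬unattached = inj₁ (B ∪ image attach R ,
                               attached⇒CDS (λ u∈R u↦nothing → ¬unattached (_ , u∈R , u↦nothing)) ,
                               ≤-trans ∣B∪attach[R]∣≤∣B∣+∣R∣ (∣B∣+∣R∣≤k n∸k≤∣∂B∣))

degree≤∣boundary∣ : {H : Graph m} {G : Graph n} → Loopless H → (M : Model H G) →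
  ∀ x → degree H x ≤ ∣ boundary G (fibre (Model.φ M) x) ∣
degree≤∣boundary∣ {H = H} {G} loopless M x = begin
  degree H x          ≡⟨ degree≡∣neighbours∣ H x ⟩
  ∣ neighbours H x ∣  ≤⟨ p⊆q⇒∣p∣≤∣q∣ neighbours⊆image ⟩
  ∣ image φ ∂B ∣      ≤⟨ ∣image∣≤∣p∣ φ ∂B ⟩
  ∣ ∂B ∣              ∎
  where
  open Model M using (φ; realises)
  open ≤-Reasoning
  B ∂B : Subset _
  B  = fibre φ x
  ∂B = boundary G B

  neighbours⊆image : neighbours H x ⊆ image φ ∂B
  neighbours⊆image {y} y∈ with realises (∈-tabulate⁻ y∈)
  ... | a , b , a↦x , b↦y , ab =
    ∈-image⁺ φ (x∈p∧x∉q⇒x∈p─q (∈-neighbourhood⁺ G B (∈-fibre⁺ φ a↦x) ab) b∉B) b↦y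
    where
    b∉B : b ∉ B
    b∉B b∈B with just-injective (trans (sym (∈-fibre⁻ φ b∈B)) b↦y)
    ... | refl with trans (sym (∈-tabulate⁻ y∈)) (loopless x)
    ...   | ()

minor⇒connected-set : {G : Graph n} → IsSimple G → ∀ {d} → 0 < d → MinorWithMaxDegree≥ G d →
  ∃[ B ] (Nonempty B × InducedConnected G B × d ≤ ∣ boundary G B ∣)
minor⇒connected-set (sym-G , loopless) 0<d (_ , H , H≼G , d≤Δ) with ≤maxDegree⇒≤degree H 0<d d≤Δ
... | x , d≤deg = fibre φ x , nonempty , connected , ≤-trans d≤deg (degree≤∣boundary∣ loopless-H M x)
  where
  loopless-H : Loopless H
  loopless-H = minor-loopless H≼G loopless
  M : Model H _
  M = minor⇒model loopless H≼G
  open Model M using (φ; realises) renaming (connected to fibre-connected)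

  nonempty : Nonempty (fibre φ x)
  nonempty with 0<∣p∣⇒Nonempty (neighbours H x)
                 (≤-trans 0<d (≤-trans d≤deg (≤-reflexive (degree≡∣neighbours∣ H x))))
  ... | y , y∈ with realises (∈-tabulate⁻ y∈)
  ...   | a , _ , a↦x , _ = a , ∈-fibre⁺ φ a↦x

  connected : InducedConnected _ (fibre φ x)
  connected a b a∈ b∈ =
    PathIn-mono (undirected-symmetric sym-G) id (fibre-connected (∈-fibre⁻ φ a∈) (∈-fibre⁻ φ b∈))

minor⇒γc≤ : {G : Graph n} → IsSimple G → ∀ {k} → MinorWithMaxDegree≥ G (n ∸ k) →
  γc≤ G k ⊎ γc≤ (complement G) k
minor⇒γc≤ {zero} _ _ = inj₁ (∅ , ((λ ()) , (λ ())) , z≤n)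
minor⇒γc≤ {suc n} simple@(sym-G , _) {k} minor with 0 <? suc n ∸ k
... | yes 0<d with minor⇒connected-set simple 0<d minor
...   | B , (b₀ , b₀∈B) , B-connected , bound =
  ConnectedSet.large-boundary⇒γc≤ sym-G b₀∈B B-connected bound
minor⇒γc≤ {suc n} {G = G} (sym-G , _) {k} minor | no ¬0<d =
  ConnectedSet.large-boundary⇒γc≤ sym-G (x∈⁅x⁆ zero) (⁅x⁆-connected G zero) (≤-trans (≮⇒≥ ¬0<d) z≤n)

-- From a connected dominating set to a large-degree minor

contract-CDS : {G : Graph (suc n)} {S : Subset (suc n)} → IsConnectedDominating G S →
  ∀ {u w} → u ∈ S → (u≢w : u ≢ w) → IsConnectedDominating (contract G u w) (removeAt S w)
contract-CDS {G = G} {S} (dominating , connected) {u} {w} u∈S u≢w = dominating′ , connected′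
  where
  open Contraction u w u≢w

  merge-∈ : ∀ {c} → c ∈ S → merge c ∈ removeAt S w
  merge-∈ {c} c∈S with c ≟ w
  ... | yes refl = ∈-removeAt⁺ (subst (_∈ S) (sym punchIn-merge-w) u∈S)
  ... | no c≢w   = ∈-removeAt⁺ (subst (_∈ S) (sym (punchIn-merge c≢w)) c∈S)

  dominating′ : Dominating (contract G u w) (removeAt S w)
  dominating′ v v∉S′ with dominating (punchIn w v) (v∉S′ ∘ ∈-removeAt⁺)
  ... | c , c∈S , cv = merge c , merge-∈ c∈S ,
    subst (λ z → contract G u w (merge c) z ≡ true) (merge-punchIn v) (contract-edge⁺ G cv merge-c≢)
    where
    merge-c≢ : merge c ≢ merge (punchIn w v)
    merge-c≢ mc≡ = v∉S′ (subst (_∈ removeAt S w) (trans mc≡ (merge-punchIn v)) (merge-∈ c∈S))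

  connected′ : InducedConnected (contract G u w) (removeAt S w)
  connected′ x y x∈ y∈ = subst₂ (PathIn _ _) (merge-punchIn x) (merge-punchIn y)
    (PathIn-map merge merge-∈ (contract-edge⁺ G) (connected _ _ (∈-removeAt⁻ x∈) (∈-removeAt⁻ y∈)))

dominating-vertex⇒degree : (G : Graph n) (v : Fin n) → (∀ a → a ≢ v → G v a ≡ true) → n ∸ 1 ≤ degree G v
dominating-vertex⇒degree {n} G v v-dominates = begin
  n ∸ 1              ≡⟨ cong (n ∸_) (sym (∣⁅x⁆∣≡1 v)) ⟩
  n ∸ ∣ ⁅ v ⁆ ∣      ≡⟨ sym (∣∁p∣≡n∸∣p∣ ⁅ v ⁆) ⟩
  ∣ ∁ ⁅ v ⁆ ∣        ≤⟨ p⊆q⇒∣p∣≤∣q∣ (λ a∈ → ∈-tabulate⁺ (v-dominates _ (x∉⁅y⁆⇒x≢y (x∈∁p⇒x∉p a∈)))) ⟩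
  ∣ neighbours G v ∣ ≡⟨ sym (degree≡∣neighbours∣ G v) ⟩
  degree G v         ∎
  where open ≤-Reasoning

Dominating⇒Nonempty : {G : Graph n} {S : Subset n} → Dominating G S → Fin n → Nonempty S
Dominating⇒Nonempty {S = S} dominating x with x ∈? S
... | yes x∈S = x , x∈S
... | no x∉S  = map₂ proj₁ (dominating x x∉S)

sole-dominator : {G : Graph n} {S : Subset n} {v : Fin n} → Dominating G S →
  ¬ (∃[ a ] (a ∈ S × a ≢ v)) → ∀ a → a ≢ v → G v a ≡ true
sole-dominator {v = v} dominating S⊆⁅v⁆ a a≢v with dominating a (λ a∈S → S⊆⁅v⁆ (a , a∈S , a≢v))
... | c , c∈S , ca with c ≟ v
...   | yes refl = ca
...   | no c≢v   = contradiction (c , c∈S , c≢v) S⊆⁅v⁆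

-- Each contraction inside S removes one vertex from both S and G, keeping n ∸ s.
CDS⇒minor : ∀ s {n} {G : Graph n} {S : Subset n} → IsConnectedDominating G S → ∣ S ∣ ≤ s →
  MinorWithMaxDegree≥ G (n ∸ s)
CDS⇒minor s       {zero}  {G} _ _ = 0 , G , done , ≤-trans (≤-reflexive (0∸n≡0 s)) z≤n
CDS⇒minor zero    {suc n} (dominating , _) ∣S∣≤0
  with ≤-trans (x∈p⇒0<∣p∣ (proj₂ (Dominating⇒Nonempty dominating zero))) ∣S∣≤0
... | ()
CDS⇒minor (suc s) {suc n} {G} {S} cds@(dominating , connected) ∣S∣≤1+s
  with Dominating⇒Nonempty dominating zero
... | v , v∈S with any? (λ a → a ∈? S ×-dec ¬? (a ≟ v))
...   | no S⊆⁅v⁆ = suc n , G , done ,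
  ≤-trans (m∸n≤m n s) (≤-trans (dominating-vertex⇒degree G v (sole-dominator dominating S⊆⁅v⁆))
                               (degree≤maxDegree G v))
...   | yes (a , a∈S , a≢v) with PathIn-distinct-edge (connected a v a∈S v∈S) a≢v
...     | c , e , c∈S , e∈S , c≢e , ce
  with CDS⇒minor s (contract-CDS cds c∈S c≢e) (≤-pred (≤-trans (∣removeAt∣<∣p∣ S e∈S) ∣S∣≤1+s))
...       | m , H , H≼G/ce , d≤Δ = m , H , contr c e ce H≼G/ce , d≤Δ

γc≤⇒minor : ∀ {k} {G : Graph n} → γc≤ G k → MinorWithMaxDegree≥ G (n ∸ k)
γc≤⇒minor {k = k} (S , cds , size) = CDS⇒minor k cds size

theorem23 : ∀ (n k : ℕ) (G : Graph n) → IsSimple G → 1 ≤ k →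
    ((∃[ m ] ∃[ H ] (Minor {m} H G × n ∸ k ≤ maxDegree H))
       ⊎ (∃[ m ] ∃[ H ] (Minor {m} H (complement G) × n ∸ k ≤ maxDegree H)))
    ⇔ (γc≤ G k ⊎ γc≤ (complement G) k)
theorem23 n k G simple _ = mk⇔
  [ minor⇒γc≤ simple
  , Sum.swap ∘ Sum.map₂ (γc≤-mono (complement-involutive⊆ G)) ∘ minor⇒γc≤ (complement-simple simple) ]
  (Sum.map γc≤⇒minor γc≤⇒minor)
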